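{- Let $\Gamma$ be a connected graph and $G$ a group of automorphisms of $\Gamma$ such that $\Gamma$ is locally $G$-arc-transitive and biregular of valence $\{3,4\}$. Suppose $\Gamma$ is unworthy, i.e. there exist two distinct vertices of $\Gamma$ with the same neighbourhood. Then $\Gamma$ is isomorphic either to the complete bipartite graph $K_{3,4}$ or to the subdivided double $\mathbb{D}_2\Lambda$ of some connected cubic graph $\Lambda$ on which $G$ acts as an arc-transitive group of automorphisms.
   Context: A graph is locally $G$-arc-transitive if for every vertex $v$ the stabiliser $G_v$ is transitive on the arcs (ordered pairs of adjacent vertices) starting at $v$. A graph is arc-transitive under a group $G$ of automorphisms if $G$ is transitive on its arcs. For a graph $\Lambda$, the subdivided double $\mathbb{D}_2\Lambda$ is the graph with vertex set the disjoint union $(\mathbb{Z}_2\times V(\Lambda))\cup E(\Lambda)$, in which $(i,w)$ is adjacent to $e\in E(\Lambda)$ whenever $w$ is an endpoint of $e$ (for any $i\in\mathbb{Z}_2$), and with no other edges. -}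

module Defs where

open import Level using (Level; _⊔_; 0ℓ) renaming (suc to lsuc)
open import Data.Bool using (Bool; true; false; _∨_)
open import Data.Nat using (ℕ)
open import Data.Fin using (Fin; _<_; _≟_)
open import Data.Product using (Σ; Σ-syntax; ∃; ∃-syntax; _×_; _,_; proj₁; proj₂)
open import Data.Sum using (_⊎_; inj₁; inj₂)
open import Function.Bundles using (_↔_; Inverse)
open import Relation.Nullary using (¬_)
open import Relation.Nullary.Decidable using (⌊_⌋)
open import Relation.Binary.PropositionalEquality using (_≡_; refl)
open import Algebra.Bundles using (Group)

record Graph : Set₁ where
  field
    V         : Set
    adj       : V → V → Bool
    adj-sym   : ∀ u v → adj u v ≡ adj v u
    adj-irr   : ∀ v → adj v v ≡ false
open Graph public

Finite : Graph → Set
Finite Γ = Σ ℕ λ n → Fin n ↔ V Γ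

data Walk (Γ : Graph) : V Γ → V Γ → Set where
  nil  : ∀ {v} → Walk Γ v v
  cons : ∀ {u v w} → adj Γ u v ≡ true → Walk Γ v w → Walk Γ u w

Connected : Graph → Set
Connected Γ = ∀ u v → Walk Γ u v

Valence : (Γ : Graph) → V Γ → ℕ → Set
Valence Γ v k = (Σ (V Γ) λ w → adj Γ v w ≡ true) ↔ Fin k

Cubic : Graph → Set
Cubic Γ = ∀ v → Valence Γ v 3

Biregular34 : Graph → Set
Biregular34 Γ = Σ (V Γ → Bool) λ part →
  (∀ u v → adj Γ u v ≡ true → ¬ (part u ≡ part v)) ×
  (∀ v → part v ≡ false → Valence Γ v 3) ×
  (∀ v → part v ≡ true → Valence Γ v 4)

Unworthy : Graph → Set
Unworthy Γ = Σ (V Γ) λ u → Σ (V Γ) λ v → ¬ (u ≡ v) × (∀ w → adj Γ u w ≡ adj Γ v w)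

record Iso (Γ Δ : Graph) : Set where
  field
    bij     : V Γ ↔ V Δ
    adj-iso : ∀ u v → adj Δ (Inverse.to bij u) (Inverse.to bij v) ≡ adj Γ u v
open Iso public

record AutGroup {c ℓ : Level} (Γ : Graph) (G : Group c ℓ) : Set (c ⊔ ℓ) where
  open Group G
  field
    act       : Carrier → V Γ → V Γ
    act-ε     : ∀ v → act ε v ≡ v
    act-∙     : ∀ g h v → act (g ∙ h) v ≡ act g (act h v)
    act-cong  : ∀ {g h} → g ≈ h → ∀ v → act g v ≡ act h v
    act-adj   : ∀ g u v → adj Γ (act g u) (act g v) ≡ adj Γ u v
    faithful  : ∀ {g h} → (∀ v → act g v ≡ act h v) → g ≈ h
open AutGroup public

LocallyArcTransitive : {c ℓ : Level} (Γ : Graph) (G : Group c ℓ) → AutGroup Γ G → Set c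
LocallyArcTransitive Γ G A = ∀ v u w → adj Γ v u ≡ true → adj Γ v w ≡ true →
  Σ (Group.Carrier G) λ g → (act A g v ≡ v) × (act A g u ≡ w)

K34-adj : Fin 3 ⊎ Fin 4 → Fin 3 ⊎ Fin 4 → Bool
K34-adj (inj₁ _) (inj₂ _) = true
K34-adj (inj₂ _) (inj₁ _) = true
K34-adj (inj₁ _) (inj₁ _) = false
K34-adj (inj₂ _) (inj₂ _) = false

K34 : Graph
K34 = record
  { V = Fin 3 ⊎ Fin 4 ; adj = K34-adj
  ; adj-sym = λ { (inj₁ _) (inj₁ _) → refl ; (inj₁ _) (inj₂ _) → refl
                ; (inj₂ _) (inj₁ _) → refl ; (inj₂ _) (inj₂ _) → refl }
  ; adj-irr = λ { (inj₁ _) → refl ; (inj₂ _) → refl } }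

-- graphs on the vertex set Fin m (used for Λ, so that edges can be
-- represented canonically as pairs (a , b) with a < b)
record FinGraph (m : ℕ) : Set where
  field
    fadj     : Fin m → Fin m → Bool
    fadj-sym : ∀ u v → fadj u v ≡ fadj v u
    fadj-irr : ∀ v → fadj v v ≡ false
open FinGraph public

toGraph : ∀ {m} → FinGraph m → Graph
toGraph {m} Λ = record { V = Fin m ; adj = fadj Λ ; adj-sym = fadj-sym Λ ; adj-irr = fadj-irr Λ }

Edge : ∀ {m} → FinGraph m → Set
Edge {m} Λ = Σ (Fin m × Fin m) λ p → (proj₁ p < proj₂ p) × (fadj Λ (proj₁ p) (proj₂ p) ≡ true)

incident : ∀ {m} (Λ : FinGraph m) → Fin m → Edge Λ → Bool
incident Λ w ((a , b) , _) = ⌊ w ≟ a ⌋ ∨ ⌊ w ≟ b ⌋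

D2-V : ∀ {m} → FinGraph m → Set
D2-V {m} Λ = (Fin 2 × Fin m) ⊎ Edge Λ

D2-adj : ∀ {m} (Λ : FinGraph m) → D2-V Λ → D2-V Λ → Bool
D2-adj Λ (inj₁ (i , w)) (inj₂ e) = incident Λ w e
D2-adj Λ (inj₂ e) (inj₁ (i , w)) = incident Λ w e
D2-adj Λ (inj₁ _) (inj₁ _) = false
D2-adj Λ (inj₂ _) (inj₂ _) = false

D2 : ∀ {m} → FinGraph m → Graph
D2 Λ = record
  { V = D2-V Λ ; adj = D2-adj Λ
  ; adj-sym = λ { (inj₁ _) (inj₁ _) → refl ; (inj₁ _) (inj₂ _) → refl
                ; (inj₂ _) (inj₁ _) → refl ; (inj₂ _) (inj₂ _) → refl }
  ; adj-irr = λ { (inj₁ _) → refl ; (inj₂ _) → refl } }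

-- Γ ≅ D₂Λ via φ, and G (acting on Γ) induces via φ an arc-transitive group of
-- automorphisms σ of Λ: g maps the twin pair {(0,w),(1,w)} to {(0,σ g w),(1,σ g w)}.
InducesArcTransitive : {c ℓ : Level} (Γ : Graph) (G : Group c ℓ) (A : AutGroup Γ G)
  {m : ℕ} (Λ : FinGraph m) (φ : Iso Γ (D2 Λ)) → Set c
InducesArcTransitive Γ G A {m} Λ φ =
  Σ (Group.Carrier G → Fin m → Fin m) λ σ →
    (∀ g i w → Σ (Fin 2) λ j →
       Inverse.to (bij φ) (act A g (Inverse.from (bij φ) (inj₁ (i , w)))) ≡ inj₁ (j , σ g w)) ×
    (∀ g u v → fadj Λ (σ g u) (σ g v) ≡ fadj Λ u v) ×
    (∀ u v u′ v′ → fadj Λ u v ≡ true → fadj Λ u′ v′ ≡ true →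
       Σ (Group.Carrier G) λ g → (σ g u ≡ u′) × (σ g v ≡ v′))

{-# OPTIONS --safe #-}
module Submission where

-- Call the vertices of valence 3 and 4 three- and four-vertices. The engine of the proof is twin-at:
-- an element of G_x moving a neighbour u of x to another neighbour y moves every twin of u to a twin
-- of y. Hence a twin pair inside a neighbourhood makes the whole neighbourhood consist of twins, and
-- connectivity spreads this through Γ.
-- If two four-vertices are twins, then all four-vertices are twins and every three-vertex is adjacent
-- to all of them, so Γ ≅ K₃,₄. Otherwise every three-vertex has a twin, and only one: three mutual
-- twins would make two neighbouring four-vertices twins. A four-vertex is then adjacent to exactly two
-- twin pairs; taking twin pairs as vertices and four-vertices as edges gives a cubic graph Λ with
-- Γ ≅ D₂Λ. G is transitive on four-vertices and the stabiliser of a four-vertex swaps its two pairs,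
-- so G acts arc-transitively on Λ.

open import Defs
open import Level using (Level)
open import Algebra.Bundles using (Group)
open import Axiom.UniquenessOfIdentityProofs using (module Decidable⇒UIP)
open import Data.Bool as Bool using (Bool; true; false)
open import Data.Bool.Properties using (¬-not)
open import Data.Empty using (⊥; ⊥-elim)
open import Data.Fin as Fin using (Fin; zero; suc)
open import Data.Fin.Patterns using (0F; 1F)
open import Data.Fin.Permutation using (↔⇒≡)
import Data.Fin.Properties as Finₚ
open import Data.List using (List; []; _∷_; length; lookup)
open import Data.List.Membership.Propositional using (_∈_; _∉_)
open import Data.List.Membership.Propositional.Properties using (∈-lookup)
open import Data.List.Relation.Unary.All as All using (All; []; _∷_)
open import Data.List.Relation.Unary.All.Properties using (¬Any⇒All¬)
open import Data.List.Relation.Unary.AllPairs using ([]; _∷_)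
import Data.List.Relation.Unary.Any as Any
open import Data.List.Relation.Unary.Any.Properties using (lookup-index)
open import Data.List.Relation.Unary.Unique.Propositional using (Unique)
open import Data.Nat as ℕ using (ℕ)
import Data.Nat.Properties as ℕₚ
open import Data.Product using (Σ; ∃; _×_; _,_; proj₁; proj₂)
open import Data.Product.Function.Dependent.Propositional using (Σ-↔)
open import Data.Sum as Sum using (_⊎_; inj₁; inj₂; [_,_]′)
open import Data.Sum.Function.Propositional using (_⊎-↔_)
open import Function using (_∘_)
open import Function.Bundles using (_↔_; Inverse; mk↔ₛ′; mk⇔)
open import Function.Properties.Inverse using (↔-refl; ↔-sym; ↔-trans)
open import Function.Related.TypeIsomorphisms using (⊎-comm)
open import Relation.Binary.Definitions using (DecidableEquality; tri<; tri≈; tri>)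
open import Relation.Binary.PropositionalEquality
open import Relation.Nullary using (¬_; Dec; yes; no; does; Irrelevant; contradiction)
open import Relation.Nullary.Decidable
  using (toSum; map′; decidable-stable; ¬?; _×-dec_; dec-true; dec-false; does-⇔)
open import Relation.Unary using (Decidable)

open Decidable⇒UIP Bool._≟_ using () renaming (≡-irrelevant to Bool-irrelevant)

≡-true-ext : {a b : Bool} → (a ≡ true → b ≡ true) → (b ≡ true → a ≡ true) → a ≡ b
≡-true-ext {false} {false} _ _ = refl
≡-true-ext {false} {true}  _ g = g refl
≡-true-ext {true}  {false} f _ = sym (f refl)
≡-true-ext {true}  {true}  _ _ = refl

does⇒ : ∀ {A : Set} (a? : Dec A) → does a? ≡ true → A
does⇒ (yes a) _ = a

lookup-injective : ∀ {A : Set} {xs : List A} → Unique xs →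
                   ∀ {i j} → lookup xs i ≡ lookup xs j → i ≡ j
lookup-injective (_ ∷ _) {zero} {zero} _ = refl
lookup-injective (x≢ ∷ _) {zero} {suc j} eq = contradiction eq (All.lookup x≢ (∈-lookup j))
lookup-injective (x≢ ∷ _) {suc i} {zero} eq = contradiction (sym eq) (All.lookup x≢ (∈-lookup i))
lookup-injective (_ ∷ u) {suc i} {suc j} eq = cong suc (lookup-injective u eq)

module _ {A : Set} where

  Σ-≡ : {P : A → Set} → (∀ {a} → Irrelevant (P a)) → {x y : Σ A P} → proj₁ x ≡ proj₁ y → x ≡ y
  Σ-≡ P-irr {a , p} {.a , q} refl = cong (a ,_) (P-irr p q)

  infix 4 _≐_
  _≐_ : A × A → A × A → Set
  (a , b) ≐ (c , d) = (a ≡ c × b ≡ d) ⊎ (a ≡ d × b ≡ c)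

  ≐-sym : ∀ {p q} → p ≐ q → q ≐ p
  ≐-sym (inj₁ (refl , refl)) = inj₁ (refl , refl)
  ≐-sym (inj₂ (refl , refl)) = inj₂ (refl , refl)

  ≐-trans : ∀ {p q r} → p ≐ q → q ≐ r → p ≐ r
  ≐-trans (inj₁ (refl , refl)) q≐r = q≐r
  ≐-trans (inj₂ (refl , refl)) (inj₁ (refl , refl)) = inj₂ (refl , refl)
  ≐-trans (inj₂ (refl , refl)) (inj₂ (refl , refl)) = inj₁ (refl , refl)

  ≐-of-members : ∀ {a b c d} → c ≢ d → c ≡ a ⊎ c ≡ b → d ≡ a ⊎ d ≡ b → (c , d) ≐ (a , b)
  ≐-of-members c≢d (inj₁ refl) (inj₁ refl) = contradiction refl c≢d
  ≐-of-members c≢d (inj₁ c≡a)  (inj₂ d≡b)  = inj₁ (c≡a , d≡b)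
  ≐-of-members c≢d (inj₂ c≡b)  (inj₁ d≡a)  = inj₂ (c≡b , d≡a)
  ≐-of-members c≢d (inj₂ refl) (inj₂ refl) = contradiction refl c≢d

  Σ-↔-irrelevant : {P Q : A → Set} → (∀ {a} → Irrelevant (P a)) → (∀ {a} → Irrelevant (Q a)) →
                   (∀ {a} → P a → Q a) → (∀ {a} → Q a → P a) → Σ A P ↔ Σ A Q
  Σ-↔-irrelevant P-irr Q-irr P⇒Q Q⇒P = mk↔ₛ′ (λ (a , p) → a , P⇒Q p) (λ (a , q) → a , Q⇒P q)
    (λ _ → Σ-≡ Q-irr refl) (λ _ → Σ-≡ P-irr refl)

  module _ (f : A → Bool) where

    private
      side : (a : A) (b : Bool) → f a ≡ b → Σ A (λ a → f a ≡ false) ⊎ Σ A (λ a → f a ≡ true)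
      side a false p = inj₁ (a , p)
      side a true  p = inj₂ (a , p)

      side-false : ∀ {a} b (q : f a ≡ b) (p : f a ≡ false) → side a b q ≡ inj₁ (a , p)
      side-false false q p = cong (λ r → inj₁ (_ , r)) (Bool-irrelevant q p)
      side-false true  q p = contradiction (trans (sym q) p) λ ()

      side-true : ∀ {a} b (q : f a ≡ b) (p : f a ≡ true) → side a b q ≡ inj₂ (a , p)
      side-true false q p = contradiction (trans (sym q) p) λ ()
      side-true true  q p = cong (λ r → inj₂ (_ , r)) (Bool-irrelevant q p)

    partition : A ↔ (Σ A (λ a → f a ≡ false) ⊎ Σ A (λ a → f a ≡ true))
    partition = mk↔ₛ′ (λ a → side a (f a) refl) [ proj₁ , proj₁ ]′
      (λ { (inj₁ (a , p)) → side-false (f a) refl p ; (inj₂ (a , p)) → side-true (f a) refl p })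
      (λ a → from-side (f a) refl)
      where
      from-side : ∀ {a} b (q : f a ≡ b) → [ proj₁ , proj₁ ]′ (side a b q) ≡ a
      from-side false _ = refl
      from-side true  _ = refl

    partition-false : ∀ {a} (p : f a ≡ false) → Inverse.to partition a ≡ inj₁ (a , p)
    partition-false = side-false _ refl

    partition-true : ∀ {a} (p : f a ≡ true) → Inverse.to partition a ≡ inj₂ (a , p)
    partition-true = side-true _ refl

enumerate : ∀ {n} {P : Fin n → Set} → Decidable P → (∀ {i} → Irrelevant (P i)) →
            Σ ℕ λ m → Fin m ↔ Σ (Fin n) P
enumerate {ℕ.zero} _ _ = 0 , mk↔ₛ′ (λ ()) (λ ()) (λ ()) (λ ())
enumerate {ℕ.suc n} {P} P? P-irr with enumerate (P? ∘ suc) P-irr | P? zero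
... | m , e | no ¬p0 = m , mk↔ₛ′ to from to-from (Inverse.strictlyInverseʳ e)
  where
  to : Fin m → Σ (Fin (ℕ.suc n)) P
  to k = let (i , p) = Inverse.to e k in suc i , p
  from : Σ (Fin (ℕ.suc n)) P → Fin m
  from (zero , p) = contradiction p ¬p0
  from (suc i , p) = Inverse.from e (i , p)
  to-from : ∀ x → to (from x) ≡ x
  to-from (zero , p) = contradiction p ¬p0
  to-from (suc i , p) = cong (λ (j , q) → suc j , q) (Inverse.strictlyInverseˡ e (i , p))
... | m , e | yes p0 = ℕ.suc m , mk↔ₛ′ to from to-from from-to
  where
  to : Fin (ℕ.suc m) → Σ (Fin (ℕ.suc n)) P
  to zero = zero , p0
  to (suc k) = let (i , p) = Inverse.to e k in suc i , p
  from : Σ (Fin (ℕ.suc n)) P → Fin (ℕ.suc m)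
  from (zero , _) = zero
  from (suc i , p) = suc (Inverse.from e (i , p))
  to-from : ∀ x → to (from x) ≡ x
  to-from (zero , p) = cong (zero ,_) (P-irr p0 p)
  to-from (suc i , p) = cong (λ (j , q) → suc j , q) (Inverse.strictlyInverseˡ e (i , p))
  from-to : ∀ k → from (to k) ≡ k
  from-to zero = refl
  from-to (suc k) = cong suc (Inverse.strictlyInverseʳ e k)

module EdgeFacts {m} (Λ : FinGraph m) where

  ends : Edge Λ → Fin m × Fin m
  ends = proj₁

  ends-distinct : ∀ E → proj₁ (ends E) ≢ proj₂ (ends E)
  ends-distinct E = Finₚ.<⇒≢ (proj₁ (proj₂ E))

  edge : ∀ {a b} → a ≢ b → fadj Λ a b ≡ true → Edge Λ
  edge {a} {b} a≢b p with Finₚ.<-cmp a b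
  ... | tri< a<b _ _ = (a , b) , a<b , p
  ... | tri≈ _ a≡b _ = contradiction a≡b a≢b
  ... | tri> _ _ b<a = (b , a) , b<a , trans (fadj-sym Λ b a) p

  edge-ends : ∀ {a b} (a≢b : a ≢ b) p → ends (edge a≢b p) ≐ (a , b)
  edge-ends {a} {b} a≢b p with Finₚ.<-cmp a b
  ... | tri< _ _ _ = inj₁ (refl , refl)
  ... | tri≈ _ a≡b _ = contradiction a≡b a≢b
  ... | tri> _ _ _ = inj₂ (refl , refl)

  Edge-≡ : ∀ {E E′ : Edge Λ} → ends E ≐ ends E′ → E ≡ E′
  Edge-≡ {(a , b) , a<b , p} {_ , c<d , q} (inj₁ (refl , refl)) =
    cong₂ (λ r s → (a , b) , r , s) (Finₚ.<-irrelevant a<b c<d) (Bool-irrelevant p q)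
  Edge-≡ {_ , a<b , _} {_ , b<a , _} (inj₂ (refl , refl)) = contradiction b<a (Finₚ.<-asym a<b)

  incident⇒ends : ∀ {w E} → incident Λ w E ≡ true → w ≡ proj₁ (ends E) ⊎ w ≡ proj₂ (ends E)
  incident⇒ends {w} {(a , b) , _} p with w Fin.≟ a | w Fin.≟ b
  ... | yes w≡a | _       = inj₁ w≡a
  ... | no _    | yes w≡b = inj₂ w≡b
  ... | no _    | no _    = contradiction p λ ()

  ends⇒incident : ∀ {w E} → w ≡ proj₁ (ends E) ⊎ w ≡ proj₂ (ends E) → incident Λ w E ≡ true
  ends⇒incident {w} {(a , b) , _} w∈ with w Fin.≟ a | w Fin.≟ b | w∈
  ... | yes _ | _     | _          = refl
  ... | no _  | yes _ | _          = refl
  ... | no w≢a | no _ | inj₁ w≡a = contradiction w≡a w≢a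
  ... | no _  | no w≢b | inj₂ w≡b = contradiction w≡b w≢b

  fadj⇒≢ : ∀ {k l} → fadj Λ k l ≡ true → k ≢ l
  fadj⇒≢ {k} p refl = contradiction (trans (sym (fadj-irr Λ k)) p) λ ()

  other-end : ∀ {k} E → incident Λ k E ≡ true → ∃ λ l → (k , l) ≐ ends E
  other-end {k} E@((a , b) , _) inc with incident⇒ends {k} {E} inc
  ... | inj₁ k≡a = b , inj₁ (k≡a , refl)
  ... | inj₂ k≡b = a , inj₂ (k≡b , refl)

  ≐-ends⇒fadj : ∀ {k l} E → (k , l) ≐ ends E → fadj Λ k l ≡ true
  ≐-ends⇒fadj (_ , _ , p) (inj₁ (refl , refl)) = p
  ≐-ends⇒fadj (_ , _ , p) (inj₂ (refl , refl)) = trans (fadj-sym Λ _ _) p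

  ≐-ends⇒incident : ∀ {k l} E → (k , l) ≐ ends E → incident Λ k E ≡ true
  ≐-ends⇒incident E (inj₁ (k≡a , _)) = ends⇒incident {E = E} (inj₁ k≡a)
  ≐-ends⇒incident E (inj₂ (k≡b , _)) = ends⇒incident {E = E} (inj₂ k≡b)

  ≐-ends-unique : ∀ {k l l′} E → (k , l) ≐ ends E → (k , l′) ≐ ends E → l ≡ l′
  ≐-ends-unique _ (inj₁ (refl , refl)) (inj₁ (_ , refl)) = refl
  ≐-ends-unique E (inj₁ (refl , _)) (inj₂ (a≡b , _)) = contradiction a≡b (ends-distinct E)
  ≐-ends-unique E (inj₂ (refl , _)) (inj₁ (b≡a , _)) = contradiction (sym b≡a) (ends-distinct E)
  ≐-ends-unique _ (inj₂ (refl , refl)) (inj₂ (_ , refl)) = refl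

  incident-edges↔neighbours : ∀ k → Σ (Edge Λ) (λ E → incident Λ k E ≡ true) ↔
                                    Σ (Fin m) (λ l → fadj Λ k l ≡ true)
  incident-edges↔neighbours k = mk↔ₛ′ to from to-from from-to
    where
    to : Σ (Edge Λ) (λ E → incident Λ k E ≡ true) → Σ (Fin m) λ l → fadj Λ k l ≡ true
    to (E , inc) = let (l , k,l≐) = other-end E inc in l , ≐-ends⇒fadj E k,l≐
    edge-to : ∀ {l} → fadj Λ k l ≡ true → Edge Λ
    edge-to {l} p = edge {k} {l} (fadj⇒≢ p) p
    edge-to-ends : ∀ {l} (p : fadj Λ k l ≡ true) → (k , l) ≐ ends (edge-to p)
    edge-to-ends {l} p = ≐-sym (edge-ends {k} {l} (fadj⇒≢ p) p)
    from : Σ (Fin m) (λ l → fadj Λ k l ≡ true) → Σ (Edge Λ) (λ E → incident Λ k E ≡ true)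
    from (l , p) = edge-to p , ≐-ends⇒incident (edge-to p) (edge-to-ends p)
    to-from : ∀ y → to (from y) ≡ y
    to-from (l , p) = Σ-≡ Bool-irrelevant
      (≐-ends-unique (edge-to p) (proj₂ (other-end (edge-to p) (proj₂ (from (l , p))))) (edge-to-ends p))
    from-to : ∀ x → from (to x) ≡ x
    from-to (E , inc) = let (l , k,l≐) = other-end E inc in
      Σ-≡ Bool-irrelevant (Edge-≡ (≐-trans (≐-sym (edge-to-ends (≐-ends⇒fadj E k,l≐))) k,l≐))

module GraphFacts (Γ : Graph) where

  infix 4 _~_
  _~_ : V Γ → V Γ → Set
  x ~ y = adj Γ x y ≡ true

  ~-sym : ∀ {x y} → x ~ y → y ~ x
  ~-sym {x} {y} = trans (adj-sym Γ y x)

  Neighbour : V Γ → Set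
  Neighbour z = Σ (V Γ) (z ~_)

  Neighbour-≡ : ∀ {z} {a b : Neighbour z} → proj₁ a ≡ proj₁ b → a ≡ b
  Neighbour-≡ = Σ-≡ Bool-irrelevant

  Twins : V Γ → V Γ → Set
  Twins a b = ∀ w → adj Γ a w ≡ adj Γ b w

  Twins-refl : ∀ {a} → Twins a a
  Twins-refl _ = refl

  Twins-sym : ∀ {a b} → Twins a b → Twins b a
  Twins-sym t w = sym (t w)

  Twins-trans : ∀ {a b d} → Twins a b → Twins b d → Twins a d
  Twins-trans t s w = trans (t w) (s w)

  Twins-~ˡ : ∀ {a b w} → Twins a b → a ~ w → b ~ w
  Twins-~ˡ {w = w} t = trans (sym (t w))

  Twins-~ʳ : ∀ {a b w} → Twins a b → w ~ a → w ~ b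
  Twins-~ʳ t = ~-sym ∘ Twins-~ˡ t ∘ ~-sym

  walk-transport : ∀ {p} (P : V Γ → Set p) → (∀ {x y} → x ~ y → P x → P y) →
                   ∀ {u w} → Walk Γ u w → P u → P w
  walk-transport P step nil = λ pu → pu
  walk-transport P step (cons e w) = walk-transport P step w ∘ step e

module FiniteGraphFacts (Γ : Graph) (fin : Finite Γ) where

  open GraphFacts Γ

  encode : V Γ → Fin (proj₁ fin)
  encode = Inverse.from (proj₂ fin)

  private
    decode : Fin (proj₁ fin) → V Γ
    decode = Inverse.to (proj₂ fin)

    decode-encode : ∀ x → decode (encode x) ≡ x
    decode-encode = Inverse.strictlyInverseˡ (proj₂ fin)

  encode-injective : ∀ {x y} → encode x ≡ encode y → x ≡ y
  encode-injective {x} {y} eq = trans (sym (decode-encode x)) (trans (cong decode eq) (decode-encode y))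

  _≟_ : DecidableEquality (V Γ)
  x ≟ y = map′ encode-injective (cong encode) (encode x Fin.≟ encode y)

  ∃? : {P : V Γ → Set} → (∀ x → Dec (P x)) → Dec (∃ P)
  ∃? {P} P? = map′ (λ (i , p) → decode i , p) (λ (x , p) → encode x , subst P (sym (decode-encode x)) p)
                   (Finₚ.any? (P? ∘ decode))

  ∀? : {P : V Γ → Set} → (∀ x → Dec (P x)) → Dec (∀ x → P x)
  ∀? {P} P? = map′ (λ h x → subst P (decode-encode x) (h (encode x))) (λ h i → h (decode i))
                   (Finₚ.all? (P? ∘ decode))

  enumerate-V : {P : V Γ → Set} → (∀ x → Dec (P x)) → (∀ {x} → Irrelevant (P x)) →
                Σ ℕ λ m → Fin m ↔ Σ (V Γ) P
  enumerate-V {P} P? P-irr = let (m , e) = enumerate (P? ∘ decode) P-irr in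
    m , ↔-trans e (Σ-↔ {A = P ∘ decode} {B = P} (proj₂ fin) ↔-refl)

  Twins? : ∀ a b → Dec (Twins a b)
  Twins? a b = ∀? (λ w → adj Γ a w Bool.≟ adj Γ b w)

  open import Data.List.Membership.DecPropositional _≟_ using (_∈?_; _∉?_)

  module _ {z k} (val : Valence Γ z k) where

    neighbour : Fin k → V Γ
    neighbour i = proj₁ (Inverse.from val i)

    neighbour-~ : ∀ i → z ~ neighbour i
    neighbour-~ i = proj₂ (Inverse.from val i)

    neighbour-injective : ∀ {i j} → neighbour i ≡ neighbour j → i ≡ j
    neighbour-injective {i} {j} eq = trans (sym (Inverse.strictlyInverseˡ val i))
      (trans (cong (Inverse.to val) (Neighbour-≡ eq)) (Inverse.strictlyInverseˡ val j))

    ∃-neighbour-∉ : ∀ xs → length xs ℕ.< k → Σ (V Γ) λ y → z ~ y × y ∉ xs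
    ∃-neighbour-∉ xs xs<k with Finₚ.any? (λ i → neighbour i ∉? xs)
    ... | yes (i , ∉) = neighbour i , neighbour-~ i , ∉
    ... | no none = contradiction (Finₚ.injective⇒≤ index-injective) (ℕₚ.<⇒≱ xs<k)
      where
      member : ∀ i → neighbour i ∈ xs
      member i = decidable-stable (neighbour i ∈? xs) (λ ∉ → none (i , ∉))
      index-injective : ∀ {i j} → Any.index (member i) ≡ Any.index (member j) → i ≡ j
      index-injective {i} {j} eq = neighbour-injective
        (trans (lookup-index (member i)) (trans (cong (lookup xs) eq) (sym (lookup-index (member j)))))

  ∈-neighbourhood : ∀ {z d} {xs : List (V Γ)} → Valence Γ z (length xs) → All (z ~_) xs → Unique xs →
                    z ~ d → d ∈ xs
  ∈-neighbourhood {z} {d} {xs} val all unique z~d with d ∈? xs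
  ... | yes d∈ = d∈
  ... | no d∉ = contradiction (Finₚ.injective⇒≤ index-injective) (ℕₚ.<-irrefl refl)
    where
    index : Fin (length (d ∷ xs)) → Fin (length xs)
    index i = Inverse.to val (lookup (d ∷ xs) i , All.lookup (z~d All.∷ all) (∈-lookup i))
    index-injective : ∀ {i j} → index i ≡ index j → i ≡ j
    index-injective eq = lookup-injective (¬Any⇒All¬ xs d∉ ∷ unique)
      (cong proj₁ (trans (sym (Inverse.strictlyInverseʳ val _))
                    (trans (cong (Inverse.from val) eq) (Inverse.strictlyInverseʳ val _))))

module AutGroupFacts {c ℓ} {Γ : Graph} {G : Group c ℓ} (A : AutGroup Γ G) where

  open Group G using (Carrier; _⁻¹; inverseˡ; inverseʳ)
  open GraphFacts Γ

  act-inverseˡ : ∀ g x → act A (g ⁻¹) (act A g x) ≡ x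
  act-inverseˡ g x = trans (sym (act-∙ A (g ⁻¹) g x)) (trans (act-cong A (inverseˡ g) x) (act-ε A x))

  act-inverseʳ : ∀ g x → act A g (act A (g ⁻¹) x) ≡ x
  act-inverseʳ g x = trans (sym (act-∙ A g (g ⁻¹) x)) (trans (act-cong A (inverseʳ g) x) (act-ε A x))

  act-injective : ∀ g {x y} → act A g x ≡ act A g y → x ≡ y
  act-injective g {x} {y} eq =
    trans (sym (act-inverseˡ g x)) (trans (cong (act A (g ⁻¹)) eq) (act-inverseˡ g y))

  act-~ : ∀ g {x y} → x ~ y → act A g x ~ act A g y
  act-~ g {x} {y} = trans (act-adj A g x y)

  act-~⁻¹ : ∀ g {x y} → act A g x ~ act A g y → x ~ y
  act-~⁻¹ g {x} {y} = trans (sym (act-adj A g x y))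

  act-Twins : ∀ g {a b} → Twins a b → Twins (act A g a) (act A g b)
  act-Twins g {a} {b} t w = begin
    adj Γ (act A g a) w                        ≡⟨ cong (adj Γ _) (sym (act-inverseʳ g w)) ⟩
    adj Γ (act A g a) (act A g (act A (g ⁻¹) w)) ≡⟨ act-adj A g a _ ⟩
    adj Γ a (act A (g ⁻¹) w)                   ≡⟨ t _ ⟩
    adj Γ b (act A (g ⁻¹) w)                   ≡⟨ sym (act-adj A g b _) ⟩
    adj Γ (act A g b) (act A g (act A (g ⁻¹) w)) ≡⟨ cong (adj Γ _) (act-inverseʳ g w) ⟩
    adj Γ (act A g b) w                        ∎
    where open ≡-Reasoning

  act-Twins⁻¹ : ∀ g {a b} → Twins (act A g a) (act A g b) → Twins a b
  act-Twins⁻¹ g {a} {b} t = subst₂ Twins (act-inverseˡ g a) (act-inverseˡ g b) (act-Twins (g ⁻¹) t)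

  act-Neighbour : ∀ g x → Neighbour x ↔ Neighbour (act A g x)
  act-Neighbour g x = mk↔ₛ′ (λ (y , p) → act A g y , act-~ g p)
    (λ (y , p) → act A (g ⁻¹) y , act-~⁻¹ g (subst (act A g x ~_) (sym (act-inverseʳ g y)) p))
    (λ _ → Neighbour-≡ (act-inverseʳ g _)) (λ _ → Neighbour-≡ (act-inverseˡ g _))

module Setting {c ℓ} (Γ : Graph) (G : Group c ℓ) (A : AutGroup Γ G) (fin : Finite Γ)
  (conn : Connected Γ) (lat : LocallyArcTransitive Γ G A) (bir : Biregular34 Γ) where

  open Group G using (Carrier; _∙_; ε; _⁻¹)
  open GraphFacts Γ
  open FiniteGraphFacts Γ fin
  open AutGroupFacts A

  part : V Γ → Bool
  part = proj₁ bir

  ~⇒part≢ : ∀ {x y} → x ~ y → part x ≢ part y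
  ~⇒part≢ = proj₁ (proj₂ bir) _ _

  valence-three : ∀ x → part x ≡ false → Valence Γ x 3
  valence-three = proj₁ (proj₂ (proj₂ bir))

  valence-four : ∀ x → part x ≡ true → Valence Γ x 4
  valence-four = proj₂ (proj₂ (proj₂ bir))

  ~-part : ∀ {x y} → x ~ y → part y ≡ Bool.not (part x)
  ~-part x~y = ¬-not (λ eq → ~⇒part≢ x~y (sym eq))

  ~-three : ∀ {x y} → x ~ y → part x ≡ true → part y ≡ false
  ~-three x~y px = trans (~-part x~y) (cong Bool.not px)

  ~-four : ∀ {x y} → x ~ y → part x ≡ false → part y ≡ true
  ~-four x~y px = trans (~-part x~y) (cong Bool.not px)

  same-part⇒¬~ : ∀ {x y} → part x ≡ part y → adj Γ x y ≡ false
  same-part⇒¬~ eq = ¬-not (λ x~y → ~⇒part≢ x~y eq)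

  degree : Bool → ℕ
  degree false = 3
  degree true  = 4

  valence : ∀ x → Valence Γ x (degree (part x))
  valence x with part x in px
  ... | false = valence-three x px
  ... | true  = valence-four x px

  some-neighbour : ∀ x → Neighbour x
  some-neighbour x with part x in px
  ... | false = Inverse.from (valence-three x px) 0F
  ... | true  = Inverse.from (valence-four x px) 0F

  part-act : ∀ g x → part (act A g x) ≡ part x
  part-act g x = degree-injective (↔⇒≡
    (↔-trans (↔-sym (valence (act A g x))) (↔-trans (↔-sym (act-Neighbour g x)) (valence x))))
    where
    degree-injective : ∀ {a b} → degree a ≡ degree b → a ≡ b
    degree-injective {false} {false} _ = refl
    degree-injective {true}  {true}  _ = refl

  Twins-part : ∀ {a b} → Twins a b → part a ≡ part b
  Twins-part {a} {b} t = let (w , a~w) = some-neighbour a in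
    trans (¬-not (~⇒part≢ a~w)) (sym (¬-not (~⇒part≢ (Twins-~ˡ t a~w))))

  twin-at : ∀ {x u v y} → x ~ u → x ~ y → Twins u v → u ≢ v →
            Σ (V Γ) λ w → x ~ w × w ≢ y × Twins w y
  twin-at {x} {u} {v} {y} x~u x~y u≈v u≢v = let (g , gx≡x , gu≡y) = lat x u y x~u x~y in
    act A g v ,
    subst (_~ act A g v) gx≡x (act-~ g (Twins-~ʳ u≈v x~u)) ,
    (λ gv≡y → u≢v (act-injective g (trans gu≡y (sym gv≡y)))) ,
    subst (Twins (act A g v)) gu≡y (act-Twins g (Twins-sym u≈v))

  twins-fill-neighbourhood : ∀ {z u v rest} → let xs = u ∷ v ∷ rest in
    Valence Γ z (ℕ.suc (length xs)) → All (z ~_) xs → Unique xs → All (Twins u) xs →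
    ∀ {d} → z ~ d → Twins u d
  twins-fill-neighbourhood {z} {u} {v} {rest} val all@(z~u ∷ _) uniq@((u≢v ∷ _) ∷ _) twins@(_ ∷ u≈v ∷ _)
                           z~d =
    twin-of (in-neighbourhood z~d)
    where
    xs = u ∷ v ∷ rest
    new = ∃-neighbour-∉ val xs (ℕₚ.n<1+n _)
    y = proj₁ new
    in-neighbourhood : ∀ {d} → z ~ d → d ∈ y ∷ xs
    in-neighbourhood = ∈-neighbourhood val (proj₁ (proj₂ new) ∷ all) (¬Any⇒All¬ xs (proj₂ (proj₂ new)) ∷ uniq)
    u≈y : Twins u y
    u≈y = let (w , z~w , w≢y , w≈y) = twin-at z~u (proj₁ (proj₂ new)) u≈v u≢v in
          Twins-trans (old-twin w≢y (in-neighbourhood z~w)) w≈y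
      where
      old-twin : ∀ {w} → w ≢ y → w ∈ y ∷ xs → Twins u w
      old-twin w≢y (Any.here w≡y) = contradiction w≡y w≢y
      old-twin _   (Any.there w∈) = All.lookup twins w∈
    twin-of : ∀ {d} → d ∈ y ∷ xs → Twins u d
    twin-of (Any.here refl) = u≈y
    twin-of (Any.there d∈) = All.lookup twins d∈

  Iso-by-parts : ∀ {Δ} (f : V Γ ↔ V Δ) → let f′ = Inverse.to f in
    (∀ {a b} → part a ≡ false → part b ≡ false → adj Δ (f′ a) (f′ b) ≡ false) →
    (∀ {a b} → part a ≡ true → part b ≡ true → adj Δ (f′ a) (f′ b) ≡ false) →
    (∀ {a b} → part a ≡ false → part b ≡ true → adj Δ (f′ a) (f′ b) ≡ adj Γ a b) →
    Iso Γ Δ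
  Iso-by-parts {Δ} f threes fours across =
    record { bij = f ; adj-iso = λ a b → by-parts (part a) (part b) refl refl }
    where
    by-parts : ∀ {a b} s t → part a ≡ s → part b ≡ t →
               adj Δ (Inverse.to f a) (Inverse.to f b) ≡ adj Γ a b
    by-parts false false pa pb = trans (threes pa pb) (sym (same-part⇒¬~ (trans pa (sym pb))))
    by-parts true  true  pa pb = trans (fours pa pb) (sym (same-part⇒¬~ (trans pa (sym pb))))
    by-parts false true  pa pb = across pa pb
    by-parts {a} {b} true false pa pb = trans (adj-sym Δ _ _) (trans (across pb pa) (adj-sym Γ b a))

  FourTwins : Set
  FourTwins = Σ (V Γ × V Γ) λ (a , b) → part a ≡ true × a ≢ b × Twins a b

  FourTwins? : Dec FourTwins
  FourTwins? = map′ (λ (a , pa , b , a≢b , a≈b) → (a , b) , pa , a≢b , a≈b)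
                    (λ ((a , b) , pa , a≢b , a≈b) → a , pa , b , a≢b , a≈b)
                    (∃? λ a → (part a Bool.≟ true) ×-dec ∃? (λ b → ¬? (a ≟ b) ×-dec Twins? a b))

  module CompleteBipartite {u v : V Γ} (u≢v : u ≢ v) (u≈v : Twins u v) (u-four : part u ≡ true) where

    twins-beyond : ∀ {z w} → u ~ z → z ~ w → Twins u w
    twins-beyond {z} u~z = twins-fill-neighbourhood (valence-three z (~-three u~z u-four))
      (~-sym u~z ∷ Twins-~ʳ u≈v (~-sym u~z) ∷ []) ((u≢v ∷ []) ∷ [] ∷ []) (Twins-refl ∷ u≈v ∷ [])

    twin-or-neighbour : ∀ z → Twins u z ⊎ u ~ z
    twin-or-neighbour z = walk-transport (λ z → Twins u z ⊎ u ~ z) step (conn u z) (inj₁ Twins-refl)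
      where
      step : ∀ {z w} → z ~ w → Twins u z ⊎ u ~ z → Twins u w ⊎ u ~ w
      step z~w (inj₁ u≈z) = inj₂ (Twins-~ˡ (Twins-sym u≈z) z~w)
      step z~w (inj₂ u~z) = inj₁ (twins-beyond u~z z~w)

    four⇒twin : ∀ {z} → part z ≡ true → Twins u z
    four⇒twin {z} pz with twin-or-neighbour z
    ... | inj₁ u≈z = u≈z
    ... | inj₂ u~z = contradiction (trans (sym pz) (~-three u~z u-four)) λ ()

    three⇒neighbour : ∀ {z} → part z ≡ false → u ~ z
    three⇒neighbour {z} pz with twin-or-neighbour z
    ... | inj₁ u≈z = contradiction (trans (sym u-four) (trans (Twins-part u≈z) pz)) λ ()
    ... | inj₂ u~z = u~z

    x : V Γ
    x = proj₁ (some-neighbour u)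

    x-three : part x ≡ false
    x-three = ~-three (proj₂ (some-neighbour u)) u-four

    sides : (Σ (V Γ) (λ z → part z ≡ false) ⊎ Σ (V Γ) (λ z → part z ≡ true)) ↔ (Fin 3 ⊎ Fin 4)
    sides = ↔-trans (⊎-comm _ _) (fours ⊎-↔ threes)
      where
      fours : Σ (V Γ) (λ z → part z ≡ true) ↔ Fin 3
      fours = ↔-trans (Σ-↔-irrelevant Bool-irrelevant Bool-irrelevant
                         (λ pz → Twins-~ʳ (four⇒twin pz) (~-sym (proj₂ (some-neighbour u))))
                         (λ x~z → ~-four x~z x-three))
                      (valence-three x x-three)
      threes : Σ (V Γ) (λ z → part z ≡ false) ↔ Fin 4
      threes = ↔-trans (Σ-↔-irrelevant Bool-irrelevant Bool-irrelevant
                          three⇒neighbour (λ u~z → ~-three u~z u-four))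
                       (valence-four u u-four)

    vertices : V Γ ↔ (Fin 3 ⊎ Fin 4)
    vertices = ↔-trans (partition part) sides

    to-three : ∀ {a} → part a ≡ false → ∃ λ i → Inverse.to vertices a ≡ inj₂ i
    to-three pa = _ , cong (Inverse.to sides) (partition-false part pa)

    to-four : ∀ {a} → part a ≡ true → ∃ λ i → Inverse.to vertices a ≡ inj₁ i
    to-four pa = _ , cong (Inverse.to sides) (partition-true part pa)

    iso : Iso Γ K34
    iso = Iso-by-parts vertices
      (λ pa pb → cong₂ K34-adj (proj₂ (to-three pa)) (proj₂ (to-three pb)))
      (λ pa pb → cong₂ K34-adj (proj₂ (to-four pa)) (proj₂ (to-four pb)))
      (λ pa pb → trans (cong₂ K34-adj (proj₂ (to-three pa)) (proj₂ (to-four pb)))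
                       (sym (Twins-~ʳ (four⇒twin pb) (~-sym (three⇒neighbour pa)))))

  ThreeVertex : Set
  ThreeVertex = Σ (V Γ) λ x → part x ≡ false

  -- label x = (i , k) says that x is the i-th member of the k-th twin pair.
  record TwinPairing : Set where
    field
      m     : ℕ
      label : ThreeVertex ↔ (Fin 2 × Fin m)
      twins⇒same-class : ∀ x y → Twins (proj₁ x) (proj₁ y) →
                         proj₂ (Inverse.to label x) ≡ proj₂ (Inverse.to label y)
      same-class⇒twins : ∀ x y → proj₂ (Inverse.to label x) ≡ proj₂ (Inverse.to label y) →
                         Twins (proj₁ x) (proj₁ y)

  module ThreeVertexTwins (no-four-twins : ∀ {a b} → part a ≡ true → Twins a b → a ≡ b)
                          {u₀ v₀ : V Γ} (u₀≢v₀ : u₀ ≢ v₀) (u₀≈v₀ : Twins u₀ v₀) where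

    HasTwin : V Γ → Set
    HasTwin y = Σ (V Γ) λ w → w ≢ y × Twins w y

    three-has-twin : ∀ {x} → part x ≡ false → HasTwin x
    three-has-twin {x} px with walk-transport (λ z → HasTwin z ⊎ (∀ {y} → z ~ y → HasTwin y)) step
                                 (conn u₀ x) (inj₁ (v₀ , u₀≢v₀ ∘ sym , Twins-sym u₀≈v₀))
      where
      step : ∀ {z w} → z ~ w → HasTwin z ⊎ (∀ {y} → z ~ y → HasTwin y) →
                               HasTwin w ⊎ (∀ {y} → w ~ y → HasTwin y)
      step z~w (inj₁ (t , t≢z , t≈z)) = inj₂ λ w~y →
        let (t′ , _ , t′≢y , t′≈y) = twin-at (~-sym z~w) w~y (Twins-sym t≈z) (t≢z ∘ sym) in
        t′ , t′≢y , t′≈y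
      step z~w (inj₂ around) = inj₁ (around z~w)
    ... | inj₁ twinned = twinned
    ... | inj₂ around = let (e , x~e) = some-neighbour x ; (w , w≢e , w≈e) = around x~e in
      contradiction (sym (no-four-twins (~-four x~e px) (Twins-sym w≈e))) w≢e

    no-three-mutual-twins : ∀ {x v w} → part x ≡ false →
      Unique (x ∷ v ∷ w ∷ []) → All (Twins x) (x ∷ v ∷ w ∷ []) → ⊥
    no-three-mutual-twins {x} px uniq twins = contradiction
      (neighbour-injective val (no-four-twins (~-four (neighbour-~ val 0F) px) e₀≈e₁)) λ ()
      where
      val = valence-three x px
      around : ∀ i {d} → neighbour val i ~ d → Twins x d
      around i = twins-fill-neighbourhood (valence-four _ (~-four (neighbour-~ val i) px))
        (All.map (λ x≈ → Twins-~ʳ x≈ (~-sym (neighbour-~ val i))) twins) uniq twins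
      e₀≈e₁ : Twins (neighbour val 0F) (neighbour val 1F)
      e₀≈e₁ d = ≡-true-ext (λ e₀~d → ~-sym (Twins-~ˡ (around 0F e₀~d) (neighbour-~ val 1F)))
                           (λ e₁~d → ~-sym (Twins-~ˡ (around 1F e₁~d) (neighbour-~ val 0F)))

    opaque
     twin : V Γ → V Γ
     twin x with ∃? (λ w → ¬? (w ≟ x) ×-dec Twins? w x)
     ... | yes (w , _) = w
     ... | no _ = x

     twin-spec : ∀ {x} → part x ≡ false → twin x ≢ x × Twins (twin x) x
     twin-spec {x} px with ∃? (λ w → ¬? (w ≟ x) ×-dec Twins? w x)
     ... | yes (_ , spec) = spec
     ... | no none = contradiction (three-has-twin px) none

    twin-three : ∀ {x} → part x ≡ false → part (twin x) ≡ false
    twin-three px = trans (Twins-part (proj₂ (twin-spec px))) px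

    twin-unique : ∀ {x w} → part x ≡ false → Twins w x → w ≡ x ⊎ w ≡ twin x
    twin-unique {x} {w} px w≈x with w ≟ x | w ≟ twin x
    ... | yes w≡x | _ = inj₁ w≡x
    ... | no _ | yes w≡tx = inj₂ w≡tx
    ... | no w≢x | no w≢tx = ⊥-elim (no-three-mutual-twins px
      (((w≢x ∘ sym) ∷ (proj₁ (twin-spec px) ∘ sym) ∷ []) ∷ (w≢tx ∷ []) ∷ [] ∷ [])
      (Twins-refl ∷ Twins-sym w≈x ∷ Twins-sym (proj₂ (twin-spec px)) ∷ []))

    twin-involutive : ∀ {x} → part x ≡ false → twin (twin x) ≡ x
    twin-involutive {x} px with twin-unique (twin-three px) (Twins-sym (proj₂ (twin-spec px)))
    ... | inj₁ x≡tx = contradiction (sym x≡tx) (proj₁ (twin-spec px))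
    ... | inj₂ x≡ttx = sym x≡ttx

    -- Twin pairs are enumerated through their member of smaller code.
    First : V Γ → Set
    First x = part x ≡ false × encode x Fin.< encode (twin x)

    First? : ∀ x → Dec (First x)
    First? x = (part x Bool.≟ false) ×-dec (encode x Fin.<? encode (twin x))

    First-irrelevant : ∀ {x} → Irrelevant (First x)
    First-irrelevant (p , lt) (q , lt′) = cong₂ _,_ (Bool-irrelevant p q) (Finₚ.<-irrelevant lt lt′)

    First-or-twin : ∀ {x} → part x ≡ false → First x ⊎ First (twin x)
    First-or-twin {x} px with Finₚ.<-cmp (encode x) (encode (twin x))
    ... | tri< lt _ _ = inj₁ (px , lt)
    ... | tri≈ _ eq _ = contradiction (encode-injective eq) (proj₁ (twin-spec px) ∘ sym)
    ... | tri> _ _ gt =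
      inj₂ (twin-three px , subst (λ y → encode (twin x) Fin.< encode y) (sym (twin-involutive px)) gt)

    First⇒¬First-twin : ∀ {x} → First x → ¬ First (twin x)
    First⇒¬First-twin {x} (px , lt) (_ , lt′) =
      Finₚ.<-asym lt (subst (λ y → encode (twin x) Fin.< encode y) (twin-involutive px) lt′)

    firsts : Σ ℕ λ m → Fin m ↔ Σ (V Γ) First
    firsts = enumerate-V First? First-irrelevant

    index : ∀ {x} → First x → Fin (proj₁ firsts)
    index f = Inverse.from (proj₂ firsts) (_ , f)

    index-cong : ∀ {x y} (f : First x) (f′ : First y) → x ≡ y → index f ≡ index f′
    index-cong f f′ refl = cong index (First-irrelevant f f′)

    first : Fin (proj₁ firsts) → V Γ
    first k = proj₁ (Inverse.to (proj₂ firsts) k)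

    first-index : ∀ {x} (f : First x) → first (index f) ≡ x
    first-index f = cong proj₁ (Inverse.strictlyInverseˡ (proj₂ firsts) (_ , f))

    label-to : ThreeVertex → Fin 2 × Fin (proj₁ firsts)
    label-to (x , px) = [ (λ f → 0F , index f) , (λ f → 1F , index f) ]′ (First-or-twin px)

    label-First : ∀ {x} px (f : First x) → label-to (x , px) ≡ (0F , index f)
    label-First px f with First-or-twin px
    ... | inj₁ f′ = cong (0F ,_) (index-cong f′ f refl)
    ... | inj₂ f′ = contradiction f′ (First⇒¬First-twin f)

    label-First-twin : ∀ {x} px (f : First (twin x)) → label-to (x , px) ≡ (1F , index f)
    label-First-twin px f with First-or-twin px
    ... | inj₁ f′ = contradiction f (First⇒¬First-twin f′)
    ... | inj₂ f′ = cong (1F ,_) (index-cong f′ f refl)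

    label-from : Fin 2 × Fin (proj₁ firsts) → ThreeVertex
    label-from (0F , k) = first k , proj₁ (proj₂ (Inverse.to (proj₂ firsts) k))
    label-from (1F , k) = twin (first k) , twin-three (proj₁ (proj₂ (Inverse.to (proj₂ firsts) k)))

    label-to-from : ∀ y → label-to (label-from y) ≡ y
    label-to-from (0F , k) = trans (label-First _ (proj₂ (Inverse.to (proj₂ firsts) k)))
                                    (cong (0F ,_) (Inverse.strictlyInverseʳ (proj₂ firsts) k))
    label-to-from (1F , k) = trans (label-First-twin _ f) (cong (1F ,_) (trans (index-cong f _ ttk≡k)
                                    (Inverse.strictlyInverseʳ (proj₂ firsts) k)))
      where
      fk = proj₂ (Inverse.to (proj₂ firsts) k)
      ttk≡k = twin-involutive (proj₁ fk)
      f : First (twin (twin (first k)))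
      f = subst First (sym ttk≡k) fk

    label-from-to : ∀ x → label-from (label-to x) ≡ x
    label-from-to (x , px) with First-or-twin px
    ... | inj₁ f = Σ-≡ Bool-irrelevant (first-index f)
    ... | inj₂ f = Σ-≡ Bool-irrelevant (trans (cong twin (first-index f)) (twin-involutive px))

    class-twin : ∀ {x} px → proj₂ (label-to (twin x , twin-three px)) ≡ proj₂ (label-to (x , px))
    class-twin {x} px = [ by-First , by-First-twin ]′ (First-or-twin px)
      where
      by-First : First x → proj₂ (label-to (twin x , twin-three px)) ≡ proj₂ (label-to (x , px))
      by-First f = let f′ = subst First (sym (twin-involutive px)) f in
        trans (cong proj₂ (label-First-twin (twin-three px) f′))
              (trans (index-cong f′ f (twin-involutive px)) (sym (cong proj₂ (label-First px f))))
      by-First-twin : First (twin x) → proj₂ (label-to (twin x , twin-three px)) ≡ proj₂ (label-to (x , px))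
      by-First-twin f =
        trans (cong proj₂ (label-First (twin-three px) f)) (sym (cong proj₂ (label-First-twin px f)))

    Twins-first : ∀ {x} px → Twins x (first (proj₂ (label-to (x , px))))
    Twins-first {x} px = [ by-First , by-First-twin ]′ (First-or-twin px)
      where
      by-First : First x → Twins x (first (proj₂ (label-to (x , px))))
      by-First f = subst (λ k → Twins x (first (proj₂ k))) (sym (label-First px f))
                         (subst (Twins x) (sym (first-index f)) Twins-refl)
      by-First-twin : First (twin x) → Twins x (first (proj₂ (label-to (x , px))))
      by-First-twin f = subst (λ k → Twins x (first (proj₂ k))) (sym (label-First-twin px f))
                              (subst (Twins x) (sym (first-index f)) (Twins-sym (proj₂ (twin-spec px))))

    pairing : TwinPairing
    pairing = record
      { m = proj₁ firsts
      ; label = mk↔ₛ′ label-to label-from label-to-from label-from-to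
      ; twins⇒same-class = twins⇒same-class
      ; same-class⇒twins = λ (x , px) (y , py) eq →
          Twins-trans (Twins-first px) (subst (λ k → Twins (first k) y) (sym eq) (Twins-sym (Twins-first py))) }
      where
      twins⇒same-class : ∀ x y → Twins (proj₁ x) (proj₁ y) → proj₂ (label-to x) ≡ proj₂ (label-to y)
      twins⇒same-class (x , px) (y , py) x≈y with twin-unique px (Twins-sym x≈y)
      ... | inj₁ refl = cong (λ p → proj₂ (label-to (x , p))) (Bool-irrelevant px py)
      ... | inj₂ refl =
        sym (trans (cong (λ p → proj₂ (label-to (twin x , p))) (Bool-irrelevant py (twin-three px)))
                                   (class-twin px))

  module SubdividedDouble (no-four-twins : ∀ {a b} → part a ≡ true → Twins a b → a ≡ b)
                          (pairing : TwinPairing) where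

    open TwinPairing pairing

    class : ∀ x → part x ≡ false → Fin m
    class x px = proj₂ (Inverse.to label (x , px))

    member : Fin 2 → Fin m → V Γ
    member i k = proj₁ (Inverse.from label (i , k))

    member-three : ∀ i k → part (member i k) ≡ false
    member-three i k = proj₂ (Inverse.from label (i , k))

    class-member : ∀ {x} i k px → x ≡ member i k → class x px ≡ k
    class-member i k px refl = cong proj₂
      (trans (cong (Inverse.to label) (Σ-≡ Bool-irrelevant refl)) (Inverse.strictlyInverseˡ label (i , k)))

    class-irrelevant : ∀ {x y} px py → x ≡ y → class x px ≡ class y py
    class-irrelevant px py refl = cong (class _) (Bool-irrelevant px py)

    member-class : ∀ x px → x ≡ member (proj₁ (Inverse.to label (x , px))) (class x px)
    member-class x px = cong proj₁ (sym (Inverse.strictlyInverseʳ label (x , px)))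

    member-injective : ∀ {i j k l} → member i k ≡ member j l → (i , k) ≡ (j , l)
    member-injective {i} {j} {k} {l} eq = trans (sym (Inverse.strictlyInverseˡ label (i , k)))
      (trans (cong (Inverse.to label) (Σ-≡ Bool-irrelevant eq)) (Inverse.strictlyInverseˡ label (j , l)))

    Twins-member : ∀ x px i → Twins x (member i (class x px))
    Twins-member x px i = same-class⇒twins (x , px) (_ , member-three i _)
      (sym (class-member i _ (member-three i _) refl))

    ~-member : ∀ {e x} px i → e ~ x → e ~ member i (class x px)
    ~-member px i = Twins-~ʳ (Twins-member _ px i)

    ~-member′ : ∀ {e i k} j → e ~ member i k → e ~ member j k
    ~-member′ {i = i} {k} j e~ = subst (λ l → _ ~ member j l) (class-member i k (member-three i k) refl)
                                         (~-member (member-three i k) j e~)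

    Joins : V Γ → Fin m → Fin m → Set
    Joins e a b = e ~ member 0F a × e ~ member 0F b

    Joins⇒four : ∀ {e a b} → Joins e a b → part e ≡ true
    Joins⇒four (e~a , _) = ~-four (~-sym e~a) (member-three 0F _)

    Joins-≐ : ∀ {e p q} → p ≐ q → Joins e (proj₁ p) (proj₂ p) → Joins e (proj₁ q) (proj₂ q)
    Joins-≐ (inj₁ (refl , refl)) j = j
    Joins-≐ (inj₂ (refl , refl)) (e~a , e~b) = e~b , e~a

    joins-covers : ∀ {e a b x} → a ≢ b → Joins e a b → ∀ px → e ~ x → class x px ≡ a ⊎ class x px ≡ b
    joins-covers {e} {a} {b} {x} a≢b j@(e~a , e~b) px e~x =
      classify (∈-neighbourhood (valence-four e (Joins⇒four j)) adjacent unique e~x)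
      where
      members = member 0F a ∷ member 1F a ∷ member 0F b ∷ member 1F b ∷ []
      adjacent : All (e ~_) members
      adjacent = e~a ∷ ~-member′ 1F e~a ∷ e~b ∷ ~-member′ 1F e~b ∷ []
      distinct : ∀ {i j k l} → (i , k) ≢ (j , l) → member i k ≢ member j l
      distinct ≢ eq = ≢ (member-injective eq)
      a≢b′ : ∀ {i j} → (i , a) ≢ (j , b)
      a≢b′ eq = a≢b (cong proj₂ eq)
      unique : Unique members
      unique = (distinct (λ ()) ∷ distinct a≢b′ ∷ distinct a≢b′ ∷ []) ∷
               (distinct a≢b′ ∷ distinct a≢b′ ∷ []) ∷ (distinct (λ ()) ∷ []) ∷ [] ∷ []
      classify : x ∈ members → class x px ≡ a ⊎ class x px ≡ b
      classify (Any.here x≡) = inj₁ (class-member 0F a px x≡)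
      classify (Any.there (Any.here x≡)) = inj₁ (class-member 1F a px x≡)
      classify (Any.there (Any.there (Any.here x≡))) = inj₂ (class-member 0F b px x≡)
      classify (Any.there (Any.there (Any.there (Any.here x≡)))) = inj₂ (class-member 1F b px x≡)

    joins-covers-member : ∀ {e a b i k} → a ≢ b → Joins e a b → e ~ member i k → k ≡ a ⊎ k ≡ b
    joins-covers-member {i = i} {k} a≢b j e~ =
      subst (λ l → l ≡ _ ⊎ l ≡ _) (class-member i k (member-three i k) refl)
            (joins-covers a≢b j (member-three i k) e~)

    covered⇒~ : ∀ {f a b x} px → Joins f a b → class x px ≡ a ⊎ class x px ≡ b → f ~ x
    covered⇒~ {x = x} px (f~a , _) (inj₁ refl) = Twins-~ʳ (Twins-sym (Twins-member x px 0F)) f~a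
    covered⇒~ {x = x} px (_ , f~b) (inj₂ refl) = Twins-~ʳ (Twins-sym (Twins-member x px 0F)) f~b

    joins-unique : ∀ {e f a b} → a ≢ b → Joins e a b → Joins f a b → e ≡ f
    joins-unique {e} {f} a≢b je jf =
      no-four-twins (Joins⇒four je) λ d → ≡-true-ext (via je jf) (via jf je)
      where
      via : ∀ {e f d} → Joins e _ _ → Joins f _ _ → e ~ d → f ~ d
      via je jf e~d = let pd = ~-three e~d (Joins⇒four je) in
        covered⇒~ pd jf (joins-covers a≢b je pd e~d)

    joins-exist : ∀ e → part e ≡ true → Σ (Fin m × Fin m) λ (a , b) → a ≢ b × Joins e a b
    joins-exist e pe = (a , b) , a≢b , e~a , ~-member pq 0F e~q
      where
      val = valence-four e pe
      py = ~-three (neighbour-~ val 0F) pe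
      a = class (neighbour val 0F) py
      e~a : e ~ member 0F a
      e~a = ~-member py 0F (neighbour-~ val 0F)
      new = ∃-neighbour-∉ val (member 0F a ∷ member 1F a ∷ []) (ℕ.s<s (ℕ.s<s ℕ.z<s))
      q = proj₁ new
      e~q = proj₁ (proj₂ new)
      pq = ~-three e~q pe
      b = class q pq
      a≢b : a ≢ b
      a≢b a≡b = proj₂ (proj₂ new)
        (a-member (proj₁ (Inverse.to label (q , pq))) (trans (member-class q pq) (cong (member _) (sym a≡b))))
        where
        a-member : ∀ i → q ≡ member i a → q ∈ member 0F a ∷ member 1F a ∷ []
        a-member 0F q≡ = Any.here q≡
        a-member 1F q≡ = Any.there (Any.here q≡)

    Adjacent : Fin m → Fin m → Set
    Adjacent a b = a ≢ b × ∃ λ e → Joins e a b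

    Adjacent? : ∀ a b → Dec (Adjacent a b)
    Adjacent? a b = ¬? (a Fin.≟ b) ×-dec
      ∃? (λ e → (adj Γ e (member 0F a) Bool.≟ true) ×-dec (adj Γ e (member 0F b) Bool.≟ true))

    Adjacent-sym : ∀ {a b} → Adjacent a b → Adjacent b a
    Adjacent-sym (a≢b , e , e~a , e~b) = (λ b≡a → a≢b (sym b≡a)) , e , e~b , e~a

    opaque
      Λ : FinGraph m
      Λ = record
        { fadj     = λ a b → does (Adjacent? a b)
        ; fadj-sym = λ a b → does-⇔ (mk⇔ Adjacent-sym Adjacent-sym) (Adjacent? a b) (Adjacent? b a)
        ; fadj-irr = λ a → dec-false (Adjacent? a a) (λ (a≢a , _) → a≢a refl) }

      Λ-adjacent : ∀ {a b} → fadj Λ a b ≡ true → Adjacent a b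
      Λ-adjacent = does⇒ (Adjacent? _ _)

      adjacent-Λ : ∀ {a b} → Adjacent a b → fadj Λ a b ≡ true
      adjacent-Λ = dec-true (Adjacent? _ _)

    open EdgeFacts Λ

    witness : Edge Λ → V Γ
    witness E = proj₁ (proj₂ (Λ-adjacent (proj₂ (proj₂ E))))

    witness-joins : ∀ E → Joins (witness E) (proj₁ (ends E)) (proj₂ (ends E))
    witness-joins E = proj₂ (proj₂ (Λ-adjacent (proj₂ (proj₂ E))))

    witness-four : ∀ E → part (witness E) ≡ true
    witness-four E = Joins⇒four (witness-joins E)

    edge-of : ∀ e → part e ≡ true → Edge Λ
    edge-of e pe = let ((a , b) , a≢b , j) = joins-exist e pe in edge a≢b (adjacent-Λ (a≢b , e , j))

    edge-of-joins : ∀ e pe → Joins e (proj₁ (ends (edge-of e pe))) (proj₂ (ends (edge-of e pe)))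
    edge-of-joins e pe = let ((a , b) , a≢b , j) = joins-exist e pe in
      Joins-≐ (≐-sym (edge-ends a≢b (adjacent-Λ (a≢b , e , j)))) j

    edge-of-witness : ∀ E → edge-of (witness E) (witness-four E) ≡ E
    edge-of-witness E =
      let ((a′ , b′) , a′≢b′ , j′@(e~a′ , e~b′)) = joins-exist (witness E) (witness-four E) in
      Edge-≡ (≐-trans (edge-ends a′≢b′ (adjacent-Λ (a′≢b′ , witness E , j′)))
        (≐-of-members a′≢b′ (joins-covers-member (ends-distinct E) (witness-joins E) e~a′)
                              (joins-covers-member (ends-distinct E) (witness-joins E) e~b′)))

    witness-edge-of : ∀ e pe → witness (edge-of e pe) ≡ e
    witness-edge-of e pe =
      joins-unique (ends-distinct (edge-of e pe)) (witness-joins (edge-of e pe)) (edge-of-joins e pe)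

    fours : Σ (V Γ) (λ e → part e ≡ true) ↔ Edge Λ
    fours = mk↔ₛ′ (λ (e , pe) → edge-of e pe) (λ E → witness E , witness-four E) edge-of-witness
                  (λ (e , pe) → Σ-≡ Bool-irrelevant (witness-edge-of e pe))

    vertices : V Γ ↔ D2-V Λ
    vertices = ↔-trans (partition part) (label ⊎-↔ fours)

    incident-edge-of : ∀ x px e pe → incident Λ (class x px) (edge-of e pe) ≡ adj Γ x e
    incident-edge-of x px e pe = ≡-true-ext
      (λ inc → ~-sym (covered⇒~ px (edge-of-joins e pe) (incident⇒ends {E = edge-of e pe} inc)))
      (λ x~e → ends⇒incident {E = edge-of e pe}
                 (joins-covers (ends-distinct (edge-of e pe)) (edge-of-joins e pe) px (~-sym x~e)))

    to-three : ∀ {x} (px : part x ≡ false) → Inverse.to vertices x ≡ inj₁ (Inverse.to label (x , px))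
    to-three px = cong (Inverse.to (label ⊎-↔ fours)) (partition-false part px)

    to-four : ∀ {e} (pe : part e ≡ true) → Inverse.to vertices e ≡ inj₂ (edge-of e pe)
    to-four pe = cong (Inverse.to (label ⊎-↔ fours)) (partition-true part pe)

    φ : Iso Γ (D2 Λ)
    φ = Iso-by-parts vertices
      (λ pa pb → cong₂ (D2-adj Λ) (to-three pa) (to-three pb))
      (λ pa pb → cong₂ (D2-adj Λ) (to-four pa) (to-four pb))
      (λ pa pb → trans (cong₂ (D2-adj Λ) (to-three pa) (to-four pb)) (incident-edge-of _ pa _ pb))

    Λ-connected : Connected (toGraph Λ)
    Λ-connected k l = subst₂ (Walk (toGraph Λ)) (class-member 0F k _ refl) (class-member 0F l _ refl)
      (project (conn (member 0F k) (member 0F l)) (member-three 0F k) (member-three 0F l))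
      where
      project : ∀ {x y} → Walk Γ x y → ∀ px py → Walk (toGraph Λ) (class x px) (class y py)
      project nil px py = subst (Walk (toGraph Λ) _) (class-irrelevant px py refl) nil
      project (cons x~e nil) px py = contradiction (trans (sym (~-four x~e px)) py) λ ()
      project {x} {z} (cons {v = e} x~e (cons {v = y} e~y w)) px pz =
        extend (class x px Fin.≟ class y py) (project w py pz)
        where
        py = ~-three e~y (~-four x~e px)
        extend : Dec (class x px ≡ class y py) → Walk (toGraph Λ) (class y py) (class z pz) →
                 Walk (toGraph Λ) (class x px) (class z pz)
        extend (yes same) rest = subst (λ k → Walk (toGraph Λ) k (class z pz)) (sym same) rest
        extend (no differ) rest =
          cons (adjacent-Λ (differ , e , ~-member px 0F (~-sym x~e) , ~-member py 0F e~y)) rest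

    Λ-cubic : Cubic (toGraph Λ)
    Λ-cubic k = ↔-trans (↔-sym (incident-edges↔neighbours k))
                (↔-trans (↔-sym incident-fours) (↔-trans flatten (valence-three x px)))
      where
      x = member 0F k
      px = member-three 0F k
      fibre : ∀ {e} → (x ~ proj₁ e) ↔ (incident Λ k (Inverse.to fours e) ≡ true)
      fibre {e , pe} = mk↔ₛ′ (trans eq) (trans (sym eq)) (λ _ → Bool-irrelevant _ _) (λ _ → Bool-irrelevant _ _)
        where
        eq : incident Λ k (edge-of e pe) ≡ adj Γ x e
        eq = trans (cong (λ l → incident Λ l (edge-of e pe)) (sym (class-member 0F k px refl)))
                   (incident-edge-of x px e pe)
      incident-fours : Σ (Σ (V Γ) (λ e → part e ≡ true)) (λ e → x ~ proj₁ e) ↔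
                       Σ (Edge Λ) (λ E → incident Λ k E ≡ true)
      incident-fours = Σ-↔ {A = λ e → x ~ proj₁ e} {B = λ E → incident Λ k E ≡ true} fours fibre
      flatten : Σ (Σ (V Γ) (λ e → part e ≡ true)) (λ e → x ~ proj₁ e) ↔ Neighbour x
      flatten = mk↔ₛ′ (λ ((e , _) , x~e) → e , x~e) (λ (e , x~e) → (e , ~-four x~e px) , x~e)
                      (λ _ → refl)
                      (λ ((e , _) , x~e) → cong (λ q → (e , q) , x~e) (Bool-irrelevant _ _))

    three-act : ∀ g {x} → part x ≡ false → part (act A g x) ≡ false
    three-act g px = trans (part-act g _) px

    σ : Carrier → Fin m → Fin m
    σ g k = class (act A g (member 0F k)) (three-act g (member-three 0F k))

    class-act : ∀ g {x} px → class (act A g x) (three-act g px) ≡ σ g (class x px)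
    class-act g {x} px = twins⇒same-class (_ , _) (_ , _) (act-Twins g (Twins-member x px 0F))

    σ-∙ : ∀ h g k → σ (h ∙ g) k ≡ σ h (σ g k)
    σ-∙ h g k = trans (class-irrelevant _ _ (act-∙ A h g (member 0F k)))
                      (class-act h (three-act g (member-three 0F k)))

    σ-injective : ∀ g {a b} → σ g a ≡ σ g b → a ≡ b
    σ-injective g {a} {b} eq = trans (sym (class-member 0F a (member-three 0F a) refl))
      (trans (twins⇒same-class (_ , _) (_ , _) (act-Twins⁻¹ g (same-class⇒twins (_ , _) (_ , _) eq)))
             (class-member 0F b (member-three 0F b) refl))

    Joins-act : ∀ g {e a b} → Joins e a b → Joins (act A g e) (σ g a) (σ g b)
    Joins-act g (e~a , e~b) = ~-member _ 0F (act-~ g e~a) , ~-member _ 0F (act-~ g e~b)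

    Joins-act⁻¹ : ∀ g {e a b} → Joins (act A g e) (σ g a) (σ g b) → Joins e a b
    Joins-act⁻¹ g (ge~a , ge~b) = act-~⁻¹ g (Twins-~ʳ (Twins-sym (Twins-member _ _ 0F)) ge~a) ,
                                  act-~⁻¹ g (Twins-~ʳ (Twins-sym (Twins-member _ _ 0F)) ge~b)

    σ-preserves-adj : ∀ g a b → fadj Λ (σ g a) (σ g b) ≡ fadj Λ a b
    σ-preserves-adj g a b = ≡-true-ext (adjacent-Λ ∘ pull ∘ Λ-adjacent) (adjacent-Λ ∘ push ∘ Λ-adjacent)
      where
      pull : Adjacent (σ g a) (σ g b) → Adjacent a b
      pull (≢ , e , j) = (≢ ∘ cong (σ g)) , act A (g ⁻¹) e ,
        Joins-act⁻¹ g (subst (λ f → Joins f _ _) (sym (act-inverseʳ g e)) j)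
      push : Adjacent a b → Adjacent (σ g a) (σ g b)
      push (≢ , e , j) = (≢ ∘ σ-injective g) , act A g e , Joins-act g j

    σ-member : ∀ g i w → Σ (Fin 2) λ j → Inverse.to vertices (act A g (member i w)) ≡ inj₁ (j , σ g w)
    σ-member g i w = j , trans (to-three py)
      (cong (λ k → inj₁ (j , k)) (trans (class-act g (member-three i w)) (cong (σ g) (class-member i w _ refl))))
      where
      py = three-act g (member-three i w)
      j = proj₁ (Inverse.to label (act A g (member i w) , py))

    four-transitive : ∀ {e f} → part e ≡ true → part f ≡ true → Σ Carrier λ g → act A g e ≡ f
    four-transitive {e} {f} pe pf with walk-transport Reach step (conn e f) (inj₁ (ε , act-ε A e))
      where
      Reach : V Γ → Set c
      Reach y = (Σ Carrier λ g → act A g e ≡ y) ⊎ (Σ Carrier λ g → act A g e ~ y)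
      step : ∀ {y z} → y ~ z → Reach y → Reach z
      step {z = z} y~z (inj₁ (g , ge≡y)) = inj₂ (g , subst (_~ z) (sym ge≡y) y~z)
      step {y} {z} y~z (inj₂ (g , ge~y)) =
        let (h , _ , hge≡z) = lat y (act A g e) z (~-sym ge~y) y~z in
        inj₁ (h ∙ g , trans (act-∙ A h g e) hge≡z)
    ... | inj₁ reached = reached
    ... | inj₂ (g , ge~f) = contradiction (trans (sym (~-three ge~f (trans (part-act g e) pe))) pf) λ ()

    ends-act : ∀ {g e e′ a b a′ b′} → a ≢ b → a′ ≢ b′ → Joins e a b → Joins e′ a′ b′ → act A g e ≡ e′ →
               (σ g a , σ g b) ≐ (a′ , b′)
    ends-act {g} a≢b a′≢b′ j j′ ge≡e′ =
      let (e′~ga , e′~gb) = subst (λ f → Joins f _ _) ge≡e′ (Joins-act g j) in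
      ≐-of-members (a≢b ∘ σ-injective g)
        (joins-covers-member a′≢b′ j′ e′~ga) (joins-covers-member a′≢b′ j′ e′~gb)

    ends-swap : ∀ {e a b} → a ≢ b → Joins e a b → Σ Carrier λ h → σ h a ≡ b × σ h b ≡ a
    ends-swap {e} {a} {b} a≢b j = h , orient (ends-act a≢b a≢b j j (proj₁ (proj₂ stabiliser)))
      where
      stabiliser = lat e (member 0F a) (member 0F b) (proj₁ j) (proj₂ j)
      h = proj₁ stabiliser
      ha≡b : σ h a ≡ b
      ha≡b = trans (class-irrelevant _ (member-three 0F b) (proj₂ (proj₂ stabiliser))) (class-member 0F b _ refl)
      orient : (σ h a , σ h b) ≐ (a , b) → σ h a ≡ b × σ h b ≡ a
      orient (inj₁ (ha≡a , _)) = contradiction (trans (sym ha≡a) ha≡b) a≢b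
      orient (inj₂ swapped) = swapped

    σ-arc-transitive : ∀ u v u′ v′ → fadj Λ u v ≡ true → fadj Λ u′ v′ ≡ true →
                       Σ Carrier λ g → σ g u ≡ u′ × σ g v ≡ v′
    σ-arc-transitive u v u′ v′ p p′ = orient (ends-act u≢v u′≢v′ j j′ (proj₂ move))
      where
      u≢v = proj₁ (Λ-adjacent p)
      j = proj₂ (proj₂ (Λ-adjacent p))
      u′≢v′ = proj₁ (Λ-adjacent p′)
      j′ = proj₂ (proj₂ (Λ-adjacent p′))
      move = four-transitive (Joins⇒four j) (Joins⇒four j′)
      g = proj₁ move
      orient : (σ g u , σ g v) ≐ (u′ , v′) → Σ Carrier λ g → σ g u ≡ u′ × σ g v ≡ v′
      orient (inj₁ moved) = g , moved
      orient (inj₂ (gu≡v′ , gv≡u′)) = let (h , hu′≡v′ , hv′≡u′) = ends-swap u′≢v′ j′ in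
        h ∙ g , trans (σ-∙ h g u) (trans (cong (σ h) gu≡v′) hv′≡u′)
              , trans (σ-∙ h g v) (trans (cong (σ h) gv≡u′) hu′≡v′)

    induced : InducesArcTransitive Γ G A Λ φ
    induced = σ , σ-member , σ-preserves-adj , σ-arc-transitive

lemma4 : {c ℓ : Level} (Γ : Graph) (G : Group c ℓ) (A : AutGroup Γ G) →
         Finite Γ → Connected Γ → LocallyArcTransitive Γ G A → Biregular34 Γ →
         Unworthy Γ →
         Iso Γ K34 ⊎
         (Σ ℕ λ m → Σ (FinGraph m) λ Λ →
            Connected (toGraph Λ) × Cubic (toGraph Λ) ×
            Σ (Iso Γ (D2 Λ)) λ φ → InducesArcTransitive Γ G A Λ φ)
lemma4 Γ G A fin conn lat bir (u , v , u≢v , u≈v) =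
  Sum.map complete-bipartite subdivided-double (toSum FourTwins?)
  where
  open GraphFacts Γ using (Twins)
  open FiniteGraphFacts Γ fin using (_≟_)
  open Setting Γ G A fin conn lat bir
  complete-bipartite : FourTwins → Iso Γ K34
  complete-bipartite ((a , b) , pa , a≢b , a≈b) = CompleteBipartite.iso a≢b a≈b pa
  subdivided-double : ¬ FourTwins → Σ ℕ λ m → Σ (FinGraph m) λ Λ →
    Connected (toGraph Λ) × Cubic (toGraph Λ) × Σ (Iso Γ (D2 Λ)) λ φ → InducesArcTransitive Γ G A Λ φ
  subdivided-double none = _ , Λ , Λ-connected , Λ-cubic , φ , induced
    where
    no-four-twins : ∀ {a b} → part a ≡ true → Twins a b → a ≡ b
    no-four-twins {a} {b} pa a≈b = decidable-stable (a ≟ b) λ a≢b → none ((a , b) , pa , a≢b , a≈b)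
    open SubdividedDouble no-four-twins (ThreeVertexTwins.pairing no-four-twins u≢v u≈v)
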